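{- Let $\pi\in S_n$ and let $\widetilde G$ be any connected component of $G_\pi$. Let $t_1$ be the number of vertices of $\widetilde G$ that are entries of $\pi$, and let $t_3$ be the number of vertices of $\widetilde G$ that are occurrences of $132$. Then $t_1\leq 2t_3+1$.
   Context: An occurrence of $132$ in $\pi\in S_n$ is a triple of positions $i<j<k$ with $\pi(i)<\pi(k)<\pi(j)$. $G_\pi$ is the bipartite graph with vertex classes $V_1$ and $V_3$. The class $V_1$ is the set of entries of $\pi$, and $V_3$ is the set of occurrences of $132$ in $\pi$. An entry is adjacent to an occurrence exactly when it is one of the three entries of that occurrence. -}

module Defs where

open import Data.Nat using (ℕ)
open import Data.Fin using (Fin; _<_)
open import Data.Fin.Permutation using (Permutation′; _⟨$⟩ʳ_)
open import Data.Product using (Σ; _×_; _,_)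
open import Data.Sum using (_⊎_; inj₁; inj₂)
open import Relation.Binary.PropositionalEquality using (_≡_)

Triple : ℕ → Set
Triple n = Fin n × Fin n × Fin n

Is132 : ∀ {n} → Permutation′ n → Triple n → Set
Is132 π (i , j , k) =
  (i < j) × (j < k) × ((π ⟨$⟩ʳ i) < (π ⟨$⟩ʳ k)) × ((π ⟨$⟩ʳ k) < (π ⟨$⟩ʳ j))

Occ : ∀ {n} → Permutation′ n → Set
Occ {n} π = Σ (Triple n) (Is132 π)

-- Vertices of G_π : entries (identified with their positions, V₁) or occurrences (V₃).
Vertex : ∀ {n} → Permutation′ n → Set
Vertex {n} π = Fin n ⊎ Occ π

Incident : ∀ {n} (π : Permutation′ n) → Fin n → Occ π → Set
Incident π e ((i , j , k) , _) = (e ≡ i) ⊎ (e ≡ j) ⊎ (e ≡ k)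

data Adj {n} (π : Permutation′ n) : Vertex π → Vertex π → Set where
  e→o : ∀ e o → Incident π e o → Adj π (inj₁ e) (inj₂ o)
  o→e : ∀ e o → Incident π e o → Adj π (inj₂ o) (inj₁ e)

-- Reachability (existence of a walk) in G_π.  The connected component of v
-- is the set of vertices w with Reach π v w.
data Reach {n} (π : Permutation′ n) : Vertex π → Vertex π → Set where
  here : ∀ {v} → Reach π v v
  step : ∀ {u v w} → Reach π u v → Adj π v w → Reach π u w

module Submission where

-- Only the incidence structure of G_π matters: a component of a 3-uniform
-- hypergraph with m hyperedges has at most 2m + 1 vertices.  Grow the component
-- from one entry, repeatedly adjoining an occurrence that shares an entry with
-- what has been collected so far; each such occurrence brings at most two new
-- entries.  When no occurrence of the component can be adjoined any more, the
-- collected entries contain every entry reachable from the start.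

open import Defs
open import Data.Nat using (suc; _≤_; _<_; _+_; _*_; s≤s)
open import Data.Nat.Properties using (*-suc; +-suc; +-comm; m≤m+n; *-monoʳ-≤; ≤-trans; ≤-reflexive; module ≤-Reasoning)
open import Data.Nat.Induction using (<-wellFounded)
open import Data.Fin using (Fin; zero; suc; _≟_)
open import Data.Fin.Permutation using (Permutation′)
open import Data.Fin.Properties using (injective⇒≤)
open import Data.List using (List; []; _∷_; length; lookup)
open import Data.List.Properties using (length-removeAt′)
open import Data.List.Membership.Propositional using (_∈_; lose)
open import Data.List.Membership.Propositional.Properties using (∈-lookup)
import Data.List.Membership.DecPropositional as DecMembership
open import Data.List.Relation.Unary.Any as Any using (Any; here; there; any?; index; _─_)
open import Data.List.Relation.Unary.Any.Properties using (lookup-index)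
import Data.List.Relation.Unary.All as All
open import Data.List.Relation.Unary.AllPairs using (_∷_)
open import Data.List.Relation.Unary.Unique.Propositional using (Unique)
open import Data.Product using (Σ; _×_; _,_; proj₁; proj₂)
open import Data.Sum using (_⊎_; inj₁; inj₂)
import Data.Sum as Sum
open import Induction.WellFounded using (Acc; acc)
open import Relation.Nullary using (Dec; yes; no; contradiction)
open import Relation.Nullary.Decidable using (_⊎-dec_)
open import Relation.Binary.Definitions using (DecidableEquality)
open import Relation.Binary.PropositionalEquality using (_≡_; refl; sym; cong; module ≡-Reasoning)
open import Function.Bundles using (_⇔_; Equivalence)

module _ {A : Set} where

  Unique-lookup-injective : ∀ {xs : List A} → Unique xs →
                            ∀ i j → lookup xs i ≡ lookup xs j → i ≡ j
  Unique-lookup-injective (_ ∷ _) zero zero _ = refl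
  Unique-lookup-injective (x≢ ∷ _) zero (suc j) eq = contradiction eq (All.lookup x≢ (∈-lookup j))
  Unique-lookup-injective (x≢ ∷ _) (suc i) zero eq = contradiction (sym eq) (All.lookup x≢ (∈-lookup i))
  Unique-lookup-injective (_ ∷ u) (suc i) (suc j) eq = cong suc (Unique-lookup-injective u i j eq)

  -- Pigeonhole: sending each position of xs to a position of the same element in ys is injective.
  Unique-⊆⇒length≤ : ∀ {xs ys : List A} → Unique xs → (∀ {x} → x ∈ xs → x ∈ ys) →
                     length xs ≤ length ys
  Unique-⊆⇒length≤ {xs} {ys} u xs⊆ys = injective⇒≤ {f = position} λ {i} {j} eq →
    Unique-lookup-injective u i j (begin
      lookup xs i               ≡⟨ lookup-index (xs⊆ys (∈-lookup i)) ⟩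
      lookup ys (position i)    ≡⟨ cong (lookup ys) eq ⟩
      lookup ys (position j)    ≡⟨ sym (lookup-index (xs⊆ys (∈-lookup j))) ⟩
      lookup xs j               ∎)
    where
    open ≡-Reasoning
    position : Fin (length xs) → Fin (length ys)
    position i = index (xs⊆ys (∈-lookup i))

  ∈-─⁻ : ∀ {P : A → Set} {xs y} (p : Any P xs) → y ∈ xs → y ≡ Any.lookup p ⊎ y ∈ (xs ─ p)
  ∈-─⁻ (here _) (here refl) = inj₁ refl
  ∈-─⁻ (here _) (there y∈) = inj₂ y∈
  ∈-─⁻ (there _) (here refl) = inj₂ (here refl)
  ∈-─⁻ (there p) (there y∈) = Sum.map₂ there (∈-─⁻ p y∈)

module _ {A : Set} where

  _∈ᵉ_ : A → A × A × A → Set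
  x ∈ᵉ (i , j , k) = x ≡ i ⊎ x ≡ j ⊎ x ≡ k

  Covers : List A → A × A × A → Set
  Covers S t = ∀ {x} → x ∈ᵉ t → x ∈ S

  Touches : List A → A × A × A → Set
  Touches S (i , j , k) = i ∈ S ⊎ j ∈ S ⊎ k ∈ S

  touches : ∀ {S x} t → x ∈ᵉ t → x ∈ S → Touches S t
  touches _ (inj₁ refl) x∈S = inj₁ x∈S
  touches _ (inj₂ (inj₁ refl)) x∈S = inj₂ (inj₁ x∈S)
  touches _ (inj₂ (inj₂ refl)) x∈S = inj₂ (inj₂ x∈S)

  attach : ∀ {S} t → Touches S t → List A
  attach {S} (i , j , k) (inj₁ _) = j ∷ k ∷ S
  attach {S} (i , j , k) (inj₂ (inj₁ _)) = i ∷ k ∷ S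
  attach {S} (i , j , k) (inj₂ (inj₂ _)) = i ∷ j ∷ S

  length-attach : ∀ {S} t (τ : Touches S t) → length (attach t τ) ≡ 2 + length S
  length-attach _ (inj₁ _) = refl
  length-attach _ (inj₂ (inj₁ _)) = refl
  length-attach _ (inj₂ (inj₂ _)) = refl

  ⊆-attach : ∀ {S x} t (τ : Touches S t) → x ∈ S → x ∈ attach t τ
  ⊆-attach _ (inj₁ _) x∈S = there (there x∈S)
  ⊆-attach _ (inj₂ (inj₁ _)) x∈S = there (there x∈S)
  ⊆-attach _ (inj₂ (inj₂ _)) x∈S = there (there x∈S)

  attach-covers : ∀ {S} t (τ : Touches S t) → Covers (attach t τ) t
  attach-covers _ (inj₁ i∈S) (inj₁ refl) = there (there i∈S)
  attach-covers _ (inj₁ _) (inj₂ (inj₁ refl)) = here refl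
  attach-covers _ (inj₁ _) (inj₂ (inj₂ refl)) = there (here refl)
  attach-covers _ (inj₂ (inj₁ _)) (inj₁ refl) = here refl
  attach-covers _ (inj₂ (inj₁ j∈S)) (inj₂ (inj₁ refl)) = there (there j∈S)
  attach-covers _ (inj₂ (inj₁ _)) (inj₂ (inj₂ refl)) = there (here refl)
  attach-covers _ (inj₂ (inj₂ _)) (inj₁ refl) = here refl
  attach-covers _ (inj₂ (inj₂ _)) (inj₂ (inj₁ refl)) = there (here refl)
  attach-covers _ (inj₂ (inj₂ k∈S)) (inj₂ (inj₂ refl)) = there (there k∈S)

module Closure {A : Set} (_≟_ : DecidableEquality A) (E : List (A × A × A)) (root : A) where

  open DecMembership _≟_ using (_∈?_)

  -- S may list an entry twice; T holds the hyperedges adjoined so far, R the rest of E.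
  record Grown : Set where
    field
      S : List A
      T R : List (A × A × A)
      root∈S : root ∈ S
      size : length S ≡ suc (2 * length T)
      budget : length T + length R ≡ length E
      covered : ∀ {t} → t ∈ T → Covers S t
      split : ∀ {t} → t ∈ E → t ∈ T ⊎ t ∈ R
  open Grown public

  Closed : Grown → Set
  Closed g = ∀ {t} → t ∈ E → Touches (S g) t → t ∈ T g

  Touches? : ∀ S t → Dec (Touches S t)
  Touches? S (i , j , k) = (i ∈? S) ⊎-dec ((j ∈? S) ⊎-dec (k ∈? S))

  initial : Grown
  initial = record
    { S = root ∷ [] ; T = [] ; R = E ; root∈S = here refl ; size = refl ; budget = refl
    ; covered = λ () ; split = inj₂ }

  grow : (g : Grown) → Any (Touches (S g)) (R g) → Grown
  grow g p = record
    { S = attach t τ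
    ; T = t ∷ T g
    ; R = R g ─ p
    ; root∈S = ⊆-attach t τ (root∈S g)
    ; size = size′
    ; budget = budget′
    ; covered = λ { (here refl) → attach-covers t τ
                  ; (there t′∈T) x∈t′ → ⊆-attach t τ (covered g t′∈T x∈t′) }
    ; split = split′
    }
    where
    t = Any.lookup p
    τ = lookup-index p
    split′ : ∀ {t′} → t′ ∈ E → t′ ∈ t ∷ T g ⊎ t′ ∈ (R g ─ p)
    split′ t′∈E with split g t′∈E
    ... | inj₁ t′∈T = inj₁ (there t′∈T)
    ... | inj₂ t′∈R with ∈-─⁻ p t′∈R
    ...   | inj₁ refl = inj₁ (here refl)
    ...   | inj₂ t′∈R─p = inj₂ t′∈R─p
    open ≡-Reasoning
    size′ : length (attach t τ) ≡ suc (2 * suc (length (T g)))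
    size′ = begin
      length (attach t τ)           ≡⟨ length-attach t τ ⟩
      2 + length (S g)              ≡⟨ cong (2 +_) (size g) ⟩
      suc (2 + 2 * length (T g))    ≡⟨ cong suc (sym (*-suc 2 (length (T g)))) ⟩
      suc (2 * suc (length (T g)))  ∎
    budget′ : suc (length (T g)) + length (R g ─ p) ≡ length E
    budget′ = begin
      suc (length (T g)) + length (R g ─ p)  ≡⟨ sym (+-suc (length (T g)) _) ⟩
      length (T g) + suc (length (R g ─ p))  ≡⟨ cong (length (T g) +_) (sym (length-removeAt′ (R g) (index p))) ⟩
      length (T g) + length (R g)            ≡⟨ budget g ⟩
      length E                               ∎

  close : (g : Grown) → Acc _<_ (length (R g)) → Σ Grown Closed
  close g (acc rec) with any? (Touches? (S g)) (R g)
  ... | yes p = close (grow g p) (rec (≤-reflexive (sym (length-removeAt′ (R g) (index p)))))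
  ... | no ¬p = g , λ t∈E τ → Sum.fromInj₁ (λ t∈R → contradiction (lose t∈R τ) ¬p) (split g t∈E)

  closure : Σ Grown Closed
  closure = close initial (<-wellFounded (length E))

  length-S≤ : (g : Grown) → length (S g) ≤ 2 * length E + 1
  length-S≤ g = begin
    length (S g)            ≡⟨ size g ⟩
    suc (2 * length (T g))  ≤⟨ s≤s (*-monoʳ-≤ 2 T≤E) ⟩
    suc (2 * length E)      ≡⟨ +-comm 1 _ ⟩
    2 * length E + 1        ∎
    where
    open ≤-Reasoning
    T≤E : length (T g) ≤ length E
    T≤E = ≤-trans (m≤m+n (length (T g)) (length (R g))) (≤-reflexive (budget g))

anchor : ∀ {n} (π : Permutation′ n) → Vertex π → Fin n
anchor _ (inj₁ e) = e
anchor _ (inj₂ ((i , _ , _) , _)) = i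

module Component {n} (π : Permutation′ n) (v : Vertex π) (E : List (Triple n))
    (reachable-occurrence∈E : ∀ {t} (p : Is132 π t) → Reach π v (inj₂ (t , p)) → t ∈ E) where

  open Closure _≟_ E (anchor π v)

  Inside : Grown → Vertex π → Set
  Inside g (inj₁ e) = e ∈ S g
  Inside g (inj₂ (t , _)) = t ∈ T g

  anchored-inside : (g : Grown) → Closed g → ∀ {w} → Reach π v w → anchor π w ∈ S g → Inside g w
  anchored-inside g closed {inj₁ e} _ e∈S = e∈S
  anchored-inside g closed {inj₂ (t , p)} r i∈S =
    closed (reachable-occurrence∈E p r) (touches t (inj₁ refl) i∈S)

  reach⇒inside : (g : Grown) → Closed g → ∀ {w} → Reach π v w → Inside g w
  reach⇒inside g closed here = anchored-inside g closed here (root∈S g)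
  reach⇒inside g closed (step r (e→o e (t , p) e∈t)) =
    closed (reachable-occurrence∈E p (step r (e→o e (t , p) e∈t))) (touches t e∈t (reach⇒inside g closed r))
  reach⇒inside g closed (step r (o→e e (t , p) e∈t)) = covered g (reach⇒inside g closed r) e∈t

lemma1 : ∀ n (π : Permutation′ n) (v : Vertex π)
         (L₁ : List (Fin n)) (L₃ : List (Triple n)) →
         Unique L₁ → Unique L₃ →
         (∀ e → (e ∈ L₁) ⇔ Reach π v (inj₁ e)) →
         (∀ t → (t ∈ L₃) ⇔ Σ (Is132 π t) (λ p → Reach π v (inj₂ (t , p)))) →
         length L₁ ≤ 2 * length L₃ + 1
lemma1 n π v L₁ L₃ u₁ _ iff₁ iff₃ = begin
  length L₁          ≤⟨ Unique-⊆⇒length≤ u₁ (λ {e} e∈L₁ → reach⇒inside g closed (Equivalence.to (iff₁ e) e∈L₁)) ⟩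
  length (S g)       ≤⟨ length-S≤ g ⟩
  2 * length L₃ + 1  ∎
  where
  open ≤-Reasoning
  open Closure _≟_ L₃ (anchor π v)
  open Component π v L₃ (λ {t} p r → Equivalence.from (iff₃ t) (p , r))
  g : Grown
  g = proj₁ closure
  closed : Closed g
  closed = proj₂ closure
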